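{- Let $\alpha\in(0,1]$. For every finite prefix normal binary word $w$ with $\delta(w)\ge\alpha$, the word $v=\mathrm{lazy}\text{ - }\alpha\text{ - }\mathrm{flipext}(w)$ is also prefix normal, and $\delta(v)\ge\alpha$.
   Context: Binary words are indexed from $1$; $P_w(i)$ is the number of $1$s in the prefix of length $i$ of $w$, $D_w(i)=P_w(i)/i$, and for a finite word $w$ the minimum density is $\delta(w)=\min\{D_w(i):1\le i\le|w|\}$. A finite binary word $w$ is prefix normal if for every $1\le i\le|w|$ every factor of $w$ of length $i$ has at most $P_w(i)$ ones. For $\alpha\in(0,1]$ and a finite prefix normal word $w$ with $\delta(w)\ge\alpha$, define $\mathrm{lazy}\text{ - }\alpha\text{ - }\mathrm{flipext}(w)=w0^k1$ where $k=\max\{j\ge 0:\delta(w0^j)\ge\alpha\}$.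
   Formalization: The parameter α ranges over the rationals in (0,1]. -}

module Defs where

open import Data.Bool using (Bool; true; false)
open import Data.Nat using (ℕ; zero; suc; _+_; _≤_; _<_)
open import Data.Integer using (+_)
open import Data.List using (List; []; _∷_; _++_; length; take; drop; replicate; map; upTo)
open import Data.Rational using (ℚ; _/_; _⊓_)
import Data.Rational as Q
open import Data.Product using (_×_)

-- a binary word; letters 1 = true, 0 = false; positions indexed from 1
Word : Set
Word = List Bool

ones : Word → ℕ
ones []          = 0
ones (true ∷ w)  = suc (ones w)
ones (false ∷ w) = ones w

P : Word → ℕ → ℕ
P w i = ones (take i w)

D : Word → (i : ℕ) → .{{_ : Data.Nat.NonZero i}} → ℚ
D w i = (+ P w i) / i

minList : ℚ → List ℚ → ℚ
minList x []       = x
minList x (y ∷ ys) = x ⊓ minList y ys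

-- δ(w) = min { D_w(i) : 1 ≤ i ≤ |w| }, for a nonempty word w = b ∷ u
δ : (b : Bool) → (u : Word) → ℚ
δ b u = minList (D (b ∷ u) 1) (map (λ j → D (b ∷ u) (suc (suc j))) (upTo (length u)))

PrefixNormal : Word → Set
PrefixNormal w = ∀ (i j : ℕ) → 1 ≤ i → j + i ≤ length w → ones (take i (drop j w)) ≤ P w i

δ-ext≥ : ℚ → Bool → Word → ℕ → Set
δ-ext≥ α b u j = α Q.≤ δ b (u ++ replicate j false)

IsLazyK : ℚ → Bool → Word → ℕ → Set
IsLazyK α b u k = δ-ext≥ α b u k × (∀ j → δ-ext≥ α b u j → j ≤ k)

{-# OPTIONS --safe #-}
module Submission where

-- Write α = p/q, so that δ(w) ≥ α says p·t ≤ q·P_w(t) for every prefix length t.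
-- Appending zeros leaves P_w unchanged, so w0^j is again prefix normal and keeps density
-- ≥ α exactly while p(|w| + j) ≤ q·ones(w); hence k = ⌊q·ones(w)/p⌋ − |w|.
-- Prefix normality is subadditivity P(j + i) ≤ P(j) + P(i) of the prefix counts. For
-- v = w0^k1 it can only fail when j + i = |v| with i, j < |v|, and there it holds: otherwise
-- P_v(j) + P_v(i) ≤ ones(w), and p|v| ≤ q(P_v(j) + P_v(i)) ≤ q·ones(w) < p|v| by maximality of k.
-- The full prefix of v keeps density ≥ α because α ≤ 1.

open import Defs
open import Function using (_∘_)
open import Function.Bundles using (_⇔_; mk⇔; Equivalence)
open import Data.Bool using (Bool; true; false)
open import Data.List using (List; []; _∷_; _++_; replicate; length)
open import Data.Product using (Σ; _×_; _,_)
open import Data.Nat using (ℕ; zero; suc)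
open import Relation.Binary.PropositionalEquality
open Equivalence using (to; from)

module OnesInPrefixes where
  open import Data.List using (_∷ʳ_; take; drop)
  open import Data.List.Properties using (length-++; length-++-≤ˡ; length-replicate; ++-assoc)
  open import Data.Nat using (_+_; _*_; _∸_; _≤_; _<_; z≤n; s≤s; NonZero)
  open import Data.Nat.Properties
  open import Data.Nat.DivMod using (_/_; _%_; m/n*n≤m; m≡m%n+[m/n]*n; m%n<n)
  open import Data.Sum using (inj₁; inj₂)

  P-[] : ∀ t → P [] t ≡ 0
  P-[] zero    = refl
  P-[] (suc t) = refl

  P-full : ∀ x {t} → length x ≤ t → P x t ≡ ones x
  P-full []          {t}     _       = P-[] t
  P-full (true ∷ x)  {suc t} (s≤s l) = cong suc (P-full x l)
  P-full (false ∷ x) {suc t} (s≤s l) = P-full x l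

  P-mono : ∀ x {i i'} → i ≤ i' → P x i ≤ P x i'
  P-mono x           {zero}           _       = z≤n
  P-mono []          {suc i} {suc i'} _       = z≤n
  P-mono (true ∷ x)  {suc i} {suc i'} (s≤s l) = s≤s (P-mono x l)
  P-mono (false ∷ x) {suc i} {suc i'} (s≤s l) = P-mono x l

  P-split : ∀ x j i → P x j + ones (take i (drop j x)) ≡ P x (j + i)
  P-split x           zero    i = refl
  P-split []          (suc j) i = P-[] i
  P-split (true ∷ x)  (suc j) i = cong suc (P-split x j i)
  P-split (false ∷ x) (suc j) i = P-split x j i

  P-zeros : ∀ k t → P (replicate k false) t ≡ 0
  P-zeros zero    t       = P-[] t
  P-zeros (suc k) zero    = refl
  P-zeros (suc k) (suc t) = P-zeros k t

  P-++-zeros : ∀ x k t → P (x ++ replicate k false) t ≡ P x t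
  P-++-zeros []          k t       = trans (P-zeros k t) (sym (P-[] t))
  P-++-zeros (_ ∷ x)     k zero    = refl
  P-++-zeros (true ∷ x)  k (suc t) = cong suc (P-++-zeros x k t)
  P-++-zeros (false ∷ x) k (suc t) = P-++-zeros x k t

  ones-++-zeros : ∀ x k → ones (x ++ replicate k false) ≡ ones x
  ones-++-zeros x k = begin
    ones y              ≡⟨ P-full y ≤-refl ⟨
    P y (length y)      ≡⟨ P-++-zeros x k (length y) ⟩
    P x (length y)      ≡⟨ P-full x (length-++-≤ˡ x) ⟩
    ones x              ∎
    where
    open ≡-Reasoning
    y = x ++ replicate k false

  length-++-zeros : ∀ x k → length (x ++ replicate k false) ≡ length x + k
  length-++-zeros x k = trans (length-++ x) (cong (length x +_) (length-replicate k))

  P-∷ʳ-true : ∀ x {t} → t ≤ length x → P (x ∷ʳ true) t ≡ P x t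
  P-∷ʳ-true x           {zero}  _       = refl
  P-∷ʳ-true (true ∷ x)  {suc t} (s≤s l) = cong suc (P-∷ʳ-true x l)
  P-∷ʳ-true (false ∷ x) {suc t} (s≤s l) = P-∷ʳ-true x l

  P-∷ʳ-true-full : ∀ x → P (x ∷ʳ true) (suc (length x)) ≡ suc (ones x)
  P-∷ʳ-true-full []          = refl
  P-∷ʳ-true-full (true ∷ x)  = cong suc (P-∷ʳ-true-full x)
  P-∷ʳ-true-full (false ∷ x) = P-∷ʳ-true-full x

  length-∷ʳ : ∀ (x : Word) c → length (x ∷ʳ c) ≡ suc (length x)
  length-∷ʳ x c = trans (length-++ x) (+-comm (length x) 1)

  P-subadditive-within : ∀ {x} → PrefixNormal x →
                         ∀ i j → j + i ≤ length x → P x (j + i) ≤ P x j + P x i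
  P-subadditive-within {x} pn i j within =
    subst (_≤ P x j + P x i) (P-split x j i) (+-monoʳ-≤ (P x j) (factor≤P i within))
    where
    factor≤P : ∀ i → j + i ≤ length x → ones (take i (drop j x)) ≤ P x i
    factor≤P zero    _ = z≤n
    factor≤P (suc i) l = pn (suc i) j (s≤s z≤n) l

  ones≤P+P : ∀ {x} → PrefixNormal x → ∀ i j → length x ≤ j + i → ones x ≤ P x j + P x i
  ones≤P+P {x} pn i j beyond with ≤-total (length x) j
  ... | inj₁ x≤j = begin
    ones x        ≡⟨ P-full x x≤j ⟨
    P x j         ≤⟨ m≤m+n (P x j) (P x i) ⟩
    P x j + P x i ∎
    where open ≤-Reasoning
  ... | inj₂ j≤x = begin
    ones x        ≡⟨ P-full x (≤-reflexive (sym j+m≡x)) ⟨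
    P x (j + m)   ≤⟨ P-subadditive-within pn m j (≤-reflexive j+m≡x) ⟩
    P x j + P x m ≤⟨ +-monoʳ-≤ (P x j) (P-mono x (m≤n+o⇒m∸n≤o (length x) j beyond)) ⟩
    P x j + P x i ∎
    where
    open ≤-Reasoning
    m = length x ∸ j
    j+m≡x : j + m ≡ length x
    j+m≡x = m+[n∸m]≡n j≤x

  prefixNormal⇒P-subadditive : ∀ {x} → PrefixNormal x → ∀ i j → P x (j + i) ≤ P x j + P x i
  prefixNormal⇒P-subadditive {x} pn i j with ≤-total (j + i) (length x)
  ... | inj₁ within = P-subadditive-within pn i j within
  ... | inj₂ beyond = subst (_≤ P x j + P x i) (sym (P-full x beyond)) (ones≤P+P pn i j beyond)

  P-subadditive⇒prefixNormal : ∀ {x} →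
    (∀ i j → 1 ≤ i → j + i ≤ length x → P x (j + i) ≤ P x j + P x i) → PrefixNormal x
  P-subadditive⇒prefixNormal {x} sub i j 1≤i l =
    +-cancelˡ-≤ (P x j) _ _ (subst (_≤ P x j + P x i) (sym (P-split x j i)) (sub i j 1≤i l))

  prefixNormal-++-zeros : ∀ {x} k → PrefixNormal x → PrefixNormal (x ++ replicate k false)
  prefixNormal-++-zeros {x} k pn = P-subadditive⇒prefixNormal λ i j _ _ →
    subst₂ _≤_ (sym (P′ (j + i))) (sym (cong₂ _+_ (P′ j) (P′ i)))
               (prefixNormal⇒P-subadditive pn i j)
    where
    P′ : ∀ t → P (x ++ replicate k false) t ≡ P x t
    P′ = P-++-zeros x k

  prefixNormal-∷ʳ-true : ∀ {x} → PrefixNormal x →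
    (∀ i j → j + i ≡ suc (length x) → i ≤ length x → j ≤ length x → ones x < P x j + P x i) →
    PrefixNormal (x ∷ʳ true)
  prefixNormal-∷ʳ-true {x} pn gap = P-subadditive⇒prefixNormal sub
    where
    y = x ∷ʳ true
    sub : ∀ i j → 1 ≤ i → j + i ≤ length y → P y (j + i) ≤ P y j + P y i
    sub i j _ l with m≤n⇒m<n∨m≡n (subst (j + i ≤_) (length-∷ʳ x true) l)
    ... | inj₁ (s≤s within) =
      subst₂ _≤_ (sym (P-∷ʳ-true x within))
                 (sym (cong₂ _+_ (P-∷ʳ-true x (m+n≤o⇒m≤o j within))
                                 (P-∷ʳ-true x (m+n≤o⇒n≤o j within))))
                 (P-subadditive-within pn i j within)
    sub i       zero    _ _ | inj₂ _    = ≤-refl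
    sub (suc i) (suc j) _ _ | inj₂ full = begin
      P y (suc j + suc i)           ≡⟨ cong (P y) full ⟩
      P y (suc (length x))          ≡⟨ P-∷ʳ-true-full x ⟩
      suc (ones x)                  ≤⟨ gap (suc i) (suc j) full i<x j<x ⟩
      P x (suc j) + P x (suc i)     ≡⟨ cong₂ _+_ (P-∷ʳ-true x j<x) (P-∷ʳ-true x i<x) ⟨
      P y (suc j) + P y (suc i)     ∎
      where
      open ≤-Reasoning
      j+1+i≡x : j + suc i ≡ length x
      j+1+i≡x = suc-injective full
      i<x : suc i ≤ length x
      i<x = m+n≤o⇒n≤o j (≤-reflexive j+1+i≡x)
      j<x : suc j ≤ length x
      j<x = m+n≤o⇒m≤o (suc j) (≤-reflexive (trans (sym (+-suc j i)) j+1+i≡x))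

  MinDensity≥ : ℕ → ℕ → Word → Set
  MinDensity≥ p q x = ∀ t → t ≤ length x → p * t ≤ P x t * q

  minDensity≥-++-zeros : ∀ {p q x} k → MinDensity≥ p q x → p * (length x + k) ≤ ones x * q →
                         MinDensity≥ p q (x ++ replicate k false)
  minDensity≥-++-zeros {p} {q} {x} k dense bound t l with ≤-total t (length x)
  ... | inj₁ t≤x = subst (λ n → p * t ≤ n * q) (sym (P-++-zeros x k t)) (dense t t≤x)
  ... | inj₂ x≤t = begin
    p * t                            ≤⟨ *-monoʳ-≤ p (subst (t ≤_) (length-++-zeros x k) l) ⟩
    p * (length x + k)               ≤⟨ bound ⟩
    ones x * q                       ≡⟨ cong (_* q) (trans (P-++-zeros x k t) (P-full x x≤t)) ⟨
    P (x ++ replicate k false) t * q ∎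
    where open ≤-Reasoning

  minDensity≥-++-zeros⁻ : ∀ {p q x} k → MinDensity≥ p q (x ++ replicate k false) →
                          p * (length x + k) ≤ ones x * q
  minDensity≥-++-zeros⁻ {p} {q} {x} k dense =
    subst₂ _≤_ (cong (p *_) (length-++-zeros x k))
               (cong (_* q) (trans (P-full y ≤-refl) (ones-++-zeros x k)))
               (dense (length y) ≤-refl)
    where y = x ++ replicate k false

  minDensity≥-∷ʳ-true : ∀ {p q x} → p ≤ q → MinDensity≥ p q x → MinDensity≥ p q (x ∷ʳ true)
  minDensity≥-∷ʳ-true {p} {q} {x} p≤q dense t l
    with m≤n⇒m<n∨m≡n (subst (t ≤_) (length-∷ʳ x true) l)
  ... | inj₁ (s≤s t≤x) = subst (λ n → p * t ≤ n * q) (sym (P-∷ʳ-true x t≤x)) (dense t t≤x)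
  ... | inj₂ refl = begin
    p * suc (length x)                   ≡⟨ *-suc p (length x) ⟩
    p + p * length x                     ≤⟨ +-mono-≤ p≤q (dense (length x) ≤-refl) ⟩
    q + P x (length x) * q               ≡⟨ cong (λ n → q + n * q) (P-full x ≤-refl) ⟩
    suc (ones x) * q                     ≡⟨ cong (_* q) (P-∷ʳ-true-full x) ⟨
    P (x ∷ʳ true) (suc (length x)) * q   ∎
    where open ≤-Reasoning

  minDensity≥⇒ones<P+P : ∀ {p q x} → MinDensity≥ p q x → ones x * q < p * suc (length x) →
    ∀ i j → j + i ≡ suc (length x) → i ≤ length x → j ≤ length x → ones x < P x j + P x i
  minDensity≥⇒ones<P+P {p} {q} {x} dense gap i j full i≤x j≤x =
    ≰⇒> λ small → n≮n _ (begin-strict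
    p * suc (length x)        ≡⟨ cong (p *_) full ⟨
    p * (j + i)               ≡⟨ *-distribˡ-+ p j i ⟩
    p * j + p * i             ≤⟨ +-mono-≤ (dense j j≤x) (dense i i≤x) ⟩
    P x j * q + P x i * q     ≡⟨ *-distribʳ-+ q (P x j) (P x i) ⟨
    (P x j + P x i) * q       ≤⟨ *-monoˡ-≤ q small ⟩
    ones x * q                <⟨ gap ⟩
    p * suc (length x)        ∎)
    where open ≤-Reasoning

  n*[m/n]≤m : ∀ m n .{{_ : NonZero n}} → n * (m / n) ≤ m
  n*[m/n]≤m m n = subst (_≤ m) (*-comm (m / n) n) (m/n*n≤m m n)

  m<n*[1+m/n] : ∀ m n .{{_ : NonZero n}} → m < n * suc (m / n)
  m<n*[1+m/n] m n = begin-strict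
    m                 ≡⟨ m≡m%n+[m/n]*n m n ⟩
    m % n + m / n * n <⟨ +-monoˡ-< (m / n * n) (m%n<n m n) ⟩
    n + m / n * n     ≡⟨ cong (n +_) (*-comm (m / n) n) ⟩
    n + n * (m / n)   ≡⟨ *-suc n (m / n) ⟨
    n * suc (m / n)   ∎
    where open ≤-Reasoning

  n*m≤o⇒m≤o/n : ∀ {m n o} .{{_ : NonZero n}} → n * m ≤ o → m ≤ o / n
  n*m≤o⇒m≤o/n {m} {n} {o} n*m≤o =
    ≮⇒≥ λ o/n<m → n≮n o (<-≤-trans (m<n*[1+m/n] o n) (≤-trans (*-monoʳ-≤ n o/n<m) n*m≤o))

  module LazyExtension {p q : ℕ} .{{_ : NonZero p}} {x : Word} (dense : MinDensity≥ p q x) where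

    k : ℕ
    k = ones x * q / p ∸ length x

    private
      y : Word
      y = x ++ replicate k false

      x+k≡floor : length x + k ≡ ones x * q / p
      x+k≡floor = m+[n∸m]≡n (n*m≤o⇒m≤o/n
        (subst (λ n → p * length x ≤ n * q) (P-full x ≤-refl) (dense (length x) ≤-refl)))

      gap : ones y * q < p * suc (length y)
      gap = subst₂ (λ o n → o * q < p * suc n)
                   (sym (ones-++-zeros x k)) (sym (trans (length-++-zeros x k) x+k≡floor))
                   (m<n*[1+m/n] (ones x * q) p)

      y∷ʳtrue≡ : y ∷ʳ true ≡ x ++ replicate k false ++ true ∷ []
      y∷ʳtrue≡ = ++-assoc x (replicate k false) (true ∷ [])

    minDensity≥-zeros : MinDensity≥ p q (x ++ replicate k false)
    minDensity≥-zeros = minDensity≥-++-zeros {p} {q} k dense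
      (subst (λ n → p * n ≤ ones x * q) (sym x+k≡floor) (n*[m/n]≤m (ones x * q) p))

    zeros-maximal : ∀ j → MinDensity≥ p q (x ++ replicate j false) → j ≤ k
    zeros-maximal j dense-j = m+n≤o⇒m≤o∸n j (subst (_≤ ones x * q / p) (+-comm (length x) j)
      (n*m≤o⇒m≤o/n (minDensity≥-++-zeros⁻ {p} {q} j dense-j)))

    prefixNormal-lazy : PrefixNormal x → PrefixNormal (x ++ replicate k false ++ true ∷ [])
    prefixNormal-lazy pn = subst PrefixNormal y∷ʳtrue≡ (prefixNormal-∷ʳ-true
      (prefixNormal-++-zeros k pn) (minDensity≥⇒ones<P+P {p} {q} minDensity≥-zeros gap))

    minDensity≥-lazy : p ≤ q → MinDensity≥ p q (x ++ replicate k false ++ true ∷ [])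
    minDensity≥-lazy p≤q =
      subst (MinDensity≥ p q) y∷ʳtrue≡ (minDensity≥-∷ʳ-true {p} {q} p≤q minDensity≥-zeros)

module RationalDensity where
  open OnesInPrefixes using (MinDensity≥)
  open import Data.List using (map; upTo)
  open import Data.List.Relation.Unary.All using (All; []; _∷_)
  import Data.List.Relation.Unary.All as All
  import Data.List.Relation.Unary.All.Properties as All
  open import Data.Nat as ℕ using (_*_; s≤s; z<s)
  import Data.Nat.Properties as ℕ
  open import Data.Nat.Coprimality using (Coprime)
  open import Data.Integer using (+_)
  import Data.Integer as ℤ
  import Data.Integer.Properties as ℤ
  open import Data.Rational using (mkℚ; _≤_; _/_; 1ℚ)
  open import Data.Rational.Properties
    using (toℚᵘ-mono-≤; toℚᵘ-cancel-≤; toℚᵘ-fromℚᵘ; p≤q⊓r⇒p≤q; p≤q⊓r⇒p≤r; ⊓-glb)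
  import Data.Rational.Unnormalised as ℚᵘ
  import Data.Rational.Unnormalised.Properties as ℚᵘ

  mkℚᵘ≤mkℚᵘ⇔ : ∀ p q a d → ℚᵘ.mkℚᵘ (+ p) q ℚᵘ.≤ ℚᵘ.mkℚᵘ (+ a) d ⇔ p * suc d ℕ.≤ a * suc q
  mkℚᵘ≤mkℚᵘ⇔ p q a d = mk⇔
    (λ { (ℚᵘ.*≤* le) →
           ℤ.drop‿+≤+ (subst₂ ℤ._≤_ (sym (ℤ.pos-* p (suc d))) (sym (ℤ.pos-* a (suc q))) le) })
    (λ le → ℚᵘ.*≤* (subst₂ ℤ._≤_ (ℤ.pos-* p (suc d)) (ℤ.pos-* a (suc q)) (ℤ.+≤+ le)))

  mkℚ≤/⇔ : ∀ {p q} .{c : Coprime p (suc q)} a d →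
           mkℚ (+ p) q c ≤ + a / suc d ⇔ p * suc d ℕ.≤ a * suc q
  mkℚ≤/⇔ {p} {q} a d = mk⇔
    (to cross ∘ ℚᵘ.≤-respʳ-≃ normalised ∘ toℚᵘ-mono-≤)
    (toℚᵘ-cancel-≤ ∘ ℚᵘ.≤-respʳ-≃ (ℚᵘ.≃-sym normalised) ∘ from cross)
    where
    cross = mkℚᵘ≤mkℚᵘ⇔ p q a d
    normalised = toℚᵘ-fromℚᵘ (ℚᵘ.mkℚᵘ (+ a) d)

  ≤minList⇔ : ∀ {α} x xs → α ≤ minList x xs ⇔ All (α ≤_) (x ∷ xs)
  ≤minList⇔ x []       = mk⇔ (_∷ []) (λ { (α≤x ∷ []) → α≤x })
  ≤minList⇔ x (y ∷ ys) = mk⇔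
    (λ α≤ → p≤q⊓r⇒p≤q x _ α≤ ∷ to rest (p≤q⊓r⇒p≤r x _ α≤))
    (λ { (α≤x ∷ α≤ys) → ⊓-glb α≤x (from rest α≤ys) })
    where rest = ≤minList⇔ y ys

  ≤δ⇔ : ∀ {α} b u → α ≤ δ b u ⇔ (∀ t → t ℕ.< length (b ∷ u) → α ≤ D (b ∷ u) (suc t))
  ≤δ⇔ {α} b u = mk⇔
    (λ α≤δ → λ where
       zero    _         → All.head (to minimum α≤δ)
       (suc t) (s≤s t<n) →
         All.applyUpTo⁻ _ (length u) (All.map⁻ (All.tail (to minimum α≤δ))) t<n)
    (λ α≤D → from minimum (α≤D 0 z<s ∷ All.map⁺ (All.applyUpTo⁺₁ _ (length u) (α≤D _ ∘ s≤s))))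
    where
    minimum = ≤minList⇔ {α} (D (b ∷ u) 1) (map (λ j → D (b ∷ u) (suc (suc j))) (upTo (length u)))

  ≤δ⇔minDensity≥ : ∀ {p q} .{c : Coprime p (suc q)} b u →
                   mkℚ (+ p) q c ≤ δ b u ⇔ MinDensity≥ p (suc q) (b ∷ u)
  ≤δ⇔minDensity≥ {p} b u = mk⇔
    (λ α≤δ → λ where
       zero    _ → ℕ.≤-reflexive (ℕ.*-zeroʳ p)
       (suc t) l → to (at t) (to (≤δ⇔ b u) α≤δ t l))
    (λ dense → from (≤δ⇔ b u) λ t l → from (at t) (dense (suc t) l))
    where
    at = λ t → mkℚ≤/⇔ (P (b ∷ u) (suc t)) t

  mkℚ≤1ℚ⇒≤ : ∀ {p q} .{c : Coprime p (suc q)} → mkℚ (+ p) q c ≤ 1ℚ → p ℕ.≤ suc q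
  mkℚ≤1ℚ⇒≤ {p} {q} α≤1 =
    subst₂ ℕ._≤_ (ℕ.*-identityʳ p) (ℕ.+-identityʳ (suc q)) (to (mkℚ≤/⇔ 1 0) α≤1)

open OnesInPrefixes using (module LazyExtension)
open RationalDensity using (≤δ⇔minDensity≥; mkℚ≤1ℚ⇒≤)
open import Data.Rational using (ℚ; 0ℚ; 1ℚ; _<_; _≤_; mkℚ; *<*)
open import Data.Integer using (+_; -[1+_]; +<+)

lemma4 : (α : ℚ) → 0ℚ < α → α ≤ 1ℚ →
         (b : Bool) (u : List Bool) → PrefixNormal (b ∷ u) → α ≤ δ b u →
         Σ ℕ (λ k → IsLazyK α b u k
                    × PrefixNormal ((b ∷ u) ++ replicate k false ++ true ∷ [])
                    × α ≤ δ b (u ++ replicate k false ++ true ∷ []))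
lemma4 (mkℚ (+ zero) _ _) (*<* (+<+ ())) _ _ _ _ _
lemma4 (mkℚ -[1+ _ ] _ _) (*<* ()) _ _ _ _ _
lemma4 (mkℚ (+ suc p) q _) _ α≤1 b u pn α≤δ =
  k , (from (≤δ⇔minDensity≥ b (u ++ replicate k false)) minDensity≥-zeros ,
       λ j → zeros-maximal j ∘ to (≤δ⇔minDensity≥ b (u ++ replicate j false))) ,
  prefixNormal-lazy pn ,
  from (≤δ⇔minDensity≥ b (u ++ replicate k false ++ true ∷ []))
       (minDensity≥-lazy (mkℚ≤1ℚ⇒≤ α≤1))
  where
  open LazyExtension {suc p} {suc q} (to (≤δ⇔minDensity≥ b u) α≤δ)
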